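{- Let $\mathcal{G}$ be the set of partitions $\lambda=(\lambda_1>\lambda_2>\cdots>\lambda_\ell)$ into distinct positive parts (empty partition included) such that $\lambda_{2i}-\lambda_{2i+1}$ is even whenever $2i+1\le\ell$, and, if $\ell$ is even, the smallest part $\lambda_\ell$ is even. Let $a(\lambda)=\lambda_1-\lambda_2+\lambda_3-\lambda_4+\cdots$ be the alternating sum of $\lambda$ and $|\lambda|$ the sum of its parts. Then $$\sum_{\lambda\in\mathcal{G}}z^{a(\lambda)}q^{|\lambda|}=\sum_{n=0}^{\infty}\frac{z^{n}q^{3n^2-2n}}{(zq;q^2)_n(q^4;q^4)_{n}}.$$
   Context: $(a;q)_n=\prod_{i=0}^{n-1}(1-aq^i)$; $|q|<1$ or formal power series. -}

module Defs where

open import Data.Nat using (ℕ; zero; suc; _+_; _*_; _∸_; _<ᵇ_; _≡ᵇ_; _%_)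
open import Data.Bool using (Bool; true; false; _∧_; if_then_else_)
open import Data.List using (List; []; _∷_)
open import Data.Integer using (ℤ; +_; _-_)

evenᵇ : ℕ → Bool
evenᵇ n = n % 2 ≡ᵇ 0

distinctPartsᵇ : List ℕ → Bool
distinctPartsᵇ []            = true
distinctPartsᵇ (x ∷ [])      = 0 <ᵇ x
distinctPartsᵇ (x ∷ y ∷ r)   = (y <ᵇ x) ∧ distinctPartsᵇ (y ∷ r)

-- Parity conditions.  `oddPosᵇ l` : l starts at an odd (1-based) index of λ;
-- `evenPosᵇ l` : l starts at an even index of λ.
--   * λ_{2i} − λ_{2i+1} even whenever 2i+1 ≤ ℓ,
--   * if ℓ is even (and ℓ ≥ 2) then λ_ℓ is even.
mutual
  oddPosᵇ : List ℕ → Bool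
  oddPosᵇ []      = true
  oddPosᵇ (x ∷ r) = evenPosᵇ r

  evenPosᵇ : List ℕ → Bool
  evenPosᵇ []          = true                      -- ℓ odd: nothing more
  evenPosᵇ (x ∷ [])    = evenᵇ x                   -- ℓ even: smallest part even
  evenPosᵇ (x ∷ y ∷ r) = evenᵇ (x ∸ y) ∧ oddPosᵇ (y ∷ r)

inGᵇ : List ℕ → Bool
inGᵇ l = distinctPartsᵇ l ∧ oddPosᵇ l

size : List ℕ → ℕ
size []      = 0
size (x ∷ r) = x + size r

altSum : List ℕ → ℤ
altSum []      = + 0
altSum (x ∷ r) = + x - altSum r

-- Formal power series in z, q with ℕ coefficients:
-- S i j = coefficient of z^i q^j.

Series : Set
Series = ℕ → ℕ → ℕ

sumUpTo : ℕ → (ℕ → ℕ) → ℕ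
sumUpTo zero    f = f 0
sumUpTo (suc n) f = sumUpTo n f + f (suc n)

sumBelow : ℕ → (ℕ → ℕ) → ℕ
sumBelow zero    f = 0
sumBelow (suc n) f = sumBelow n f + f n

[_≡ᵇ_] : ℕ → ℕ → ℕ
[ m ≡ᵇ n ] = if m ≡ᵇ n then 1 else 0

_⊛_ : Series → Series → Series
(f ⊛ g) i j = sumUpTo i λ a → sumUpTo j λ b → f a b * g (i ∸ a) (j ∸ b)

one : Series
one i j = [ i ≡ᵇ 0 ] * [ j ≡ᵇ 0 ]

mono : ℕ → ℕ → Series
mono a b i j = [ i ≡ᵇ a ] * [ j ≡ᵇ b ]

-- 1 / (1 − z^a q^b) = Σ_{k ≥ 0} z^{ka} q^{kb}, for b ≥ 1
-- (the coefficient of q^j only involves k ≤ j since b ≥ 1)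
geomInv : ℕ → ℕ → Series
geomInv a b i j = sumUpTo j λ k → [ i ≡ᵇ k * a ] * [ j ≡ᵇ k * b ]

prodBelow : ℕ → (ℕ → Series) → Series
prodBelow zero    F = one
prodBelow (suc n) F = prodBelow n F ⊛ F n

invPochZq : ℕ → Series
invPochZq n = prodBelow n λ k → geomInv 1 (2 * k + 1)

invPochQ4 : ℕ → Series
invPochQ4 n = prodBelow n λ k → geomInv 0 (4 * k + 4)

rhsTerm : ℕ → Series
rhsTerm n = (mono n (3 * n * n ∸ 2 * n) ⊛ invPochZq n) ⊛ invPochQ4 n

-- Σ_{n ≥ 0} rhsTerm n : the n-th term has q-degree ≥ 3n²−2n ≥ n,
-- so the coefficient of q^j only receives contributions from n ≤ j.
rhs : Series
rhs i j = sumUpTo j λ n → rhsTerm n i j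

-- Expanding the n-th summand of the right-hand side, a monomial is z^n q^(3n²−2n) times a choice
-- of multiplicities c_k of z q^(2k+1) and h_k of q^(4k+4), k < n.  Such data are in bijection with
-- the λ ∈ 𝒢 having ⌈ℓ/2⌉ = n: cut λ into pairs (λ_(2k+1), λ_(2k+2)), k < n, from the top (with
-- λ_(2n) = 0 when ℓ is odd and λ_(2n+1) read as −2), and set λ_(2k+1) − λ_(2k+2) = c_k + 1 and
-- λ_(2k+2) − λ_(2k+3) = 2 h_k + 2; the parity conditions of 𝒢 say exactly that these gaps exist.
-- Raising c_k raises the 2k+1 largest parts by one and a(λ) by one; raising h_k raises the 2k+2
-- largest parts by two and leaves a(λ) unchanged; all multiplicities zero give the parts
-- (3k+1, 3k), k < n, of size 3n²−2n and alternating sum n.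

module Submission where

open import Defs
open import Axiom.UniquenessOfIdentityProofs using (module Decidable⇒UIP)
open import Data.Bool using (true; false; T; _∧_; if_then_else_)
open import Data.Bool.Properties using (T-irrelevant; T-∧)
open import Data.Fin using (Fin)
open import Data.Fin.Properties using (0↔⊥; 1↔⊤; *↔×; +↔⊎)
open import Data.Integer as ℤ using (+_)
open import Data.Integer.Properties using (+-injective)
import Data.Integer.Tactic.RingSolver as ℤ-Solver
open import Data.List using (List; []; _∷_)
open import Data.Nat using (ℕ; zero; suc; _+_; _*_; _∸_; _≤_; _<_; z≤n; s≤s; z<s; _≡ᵇ_; _<ᵇ_; _%_; _/_; >-nonZero)
open import Data.Nat.DivMod using (m*n/n≡m; m*[n/m]≡n)
open import Data.Nat.Divisibility using (_∣_; m∣m*n; m%n≡0⇒n∣m; n∣m⇒m%n≡0)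
open import Data.Nat.Properties
open import Data.Nat.Tactic.RingSolver using (solve-∀)
open import Data.Product using (Σ; _×_; _,_; proj₁; proj₂)
open import Data.Product.Function.Dependent.Propositional using (Σ-↔)
open import Data.Product.Function.NonDependent.Propositional using (_×-↔_)
open import Data.Product.Properties using (Σ-≡,≡→≡)
open import Data.Sum using (_⊎_; inj₁; inj₂)
open import Data.Sum.Function.Propositional using (_⊎-↔_)
open import Data.Unit using (⊤; tt)
open import Data.Vec using (Vec; []; _∷_; _∷ʳ_; init; last; initLast; sum)
open import Data.Vec.Properties using (init-∷ʳ; last-∷ʳ)
open import Function using (_∘_)
open import Function.Bundles using (_↔_; mk↔ₛ′; Inverse; Equivalence)
open import Function.Properties.Inverse using (↔-refl; ↔-sym; ↔-trans)
open import Function.Related.TypeIsomorphisms using (Σ-assoc)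
open import Relation.Binary.PropositionalEquality hiding ([_])
open import Relation.Nullary using (¬_; Irrelevant; contradiction)

private
  variable
    A B : Set
    n : ℕ

×-irrelevant : Irrelevant A → Irrelevant B → Irrelevant (A × B)
×-irrelevant irrA irrB (a , b) (a′ , b′) = cong₂ _,_ (irrA a a′) (irrB b b′)

↔-restrict : {P : A → Set} {Q : B → Set} →
  (∀ {a} → Irrelevant (P a)) → (∀ {b} → Irrelevant (Q b)) →
  (f : A → B) (g : B → A) → (∀ {a} → P a → Q (f a)) → (∀ {b} → Q b → P (g b)) →
  (∀ {a} → P a → g (f a) ≡ a) → (∀ {b} → Q b → f (g b) ≡ b) →
  Σ A P ↔ Σ B Q
↔-restrict irrP irrQ f g pf qg gf fg = mk↔ₛ′
  (λ (a , p) → f a , pf p) (λ (b , q) → g b , qg q)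
  (λ (b , q) → Σ-≡,≡→≡ (fg q , irrQ _ _)) (λ (a , p) → Σ-≡,≡→≡ (gf p , irrP _ _))

irrelevant-⇔ : {P Q : Set} → Irrelevant P → Irrelevant Q → (P → Q) → (Q → P) → P ↔ Q
irrelevant-⇔ irrP irrQ f g = mk↔ₛ′ f g (λ _ → irrQ _ _) (λ _ → irrP _ _)

Fin-if↔T : ∀ b → Fin (if b then 1 else 0) ↔ T b
Fin-if↔T true  = 1↔⊤
Fin-if↔T false = 0↔⊥

Fin-[≡ᵇ]↔≡ : ∀ m n → Fin [ m ≡ᵇ n ] ↔ (n ≡ m)
Fin-[≡ᵇ]↔≡ m n = ↔-trans (Fin-if↔T (m ≡ᵇ n))
  (irrelevant-⇔ T-irrelevant ≡-irrelevant (sym ∘ ≡ᵇ⇒≡ m n) (≡⇒≡ᵇ m n ∘ sym))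

Σ≤ : ℕ → (ℕ → Set) → Set
Σ≤ n X = Σ ℕ λ k → k ≤ n × X k

Σ≤-cong : {X Y : ℕ → Set} → (∀ k → X k ↔ Y k) → Σ≤ n X ↔ Σ≤ n Y
Σ≤-cong e = Σ-↔ ↔-refl (λ {k} → ↔-refl ×-↔ e k)

Σ≤-suc↔ : {X : ℕ → Set} → (Σ≤ n X ⊎ X (suc n)) ↔ Σ≤ (suc n) X
Σ≤-suc↔ {n} {X} = mk↔ₛ′ to from to∘from from∘to
  where
  to : Σ≤ n X ⊎ X (suc n) → Σ≤ (suc n) X
  to (inj₁ (k , k≤n , x)) = k , m≤n⇒m≤1+n k≤n , x
  to (inj₂ x)             = suc n , ≤-refl , x

  from′ : ∀ k → X k → k < suc n ⊎ k ≡ suc n → Σ≤ n X ⊎ X (suc n)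
  from′ k x (inj₁ k<1+n)    = inj₁ (k , ≤-pred k<1+n , x)
  from′ .(suc n) x (inj₂ refl) = inj₂ x

  from : Σ≤ (suc n) X → Σ≤ n X ⊎ X (suc n)
  from (k , k≤1+n , x) = from′ k x (m≤n⇒m<n∨m≡n k≤1+n)

  to∘from : ∀ y → to (from y) ≡ y
  to∘from (k , k≤1+n , x) with m≤n⇒m<n∨m≡n k≤1+n
  ... | inj₁ _    = cong (λ p → k , p , x) (≤-irrelevant _ _)
  ... | inj₂ refl = cong (λ p → k , p , x) (≤-irrelevant _ _)

  from∘to : ∀ y → from (to y) ≡ y
  from∘to (inj₁ (k , k≤n , x)) with m≤n⇒m<n∨m≡n (m≤n⇒m≤1+n k≤n)
  ... | inj₁ _    = cong (λ p → inj₁ (k , p , x)) (≤-irrelevant _ _)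
  ... | inj₂ refl = contradiction k≤n (n≮n n)
  from∘to (inj₂ x) with m≤n⇒m<n∨m≡n (≤-refl {suc n})
  ... | inj₁ n<n  = contradiction n<n (n≮n (suc n))
  ... | inj₂ refl = refl

Fin-sumUpTo↔ : ∀ n (f : ℕ → ℕ) → Fin (sumUpTo n f) ↔ Σ≤ n (Fin ∘ f)
Fin-sumUpTo↔ zero    f =
  mk↔ₛ′ (λ x → 0 , z≤n , x) (λ { (0 , z≤n , x) → x }) (λ { (0 , z≤n , x) → refl }) (λ _ → refl)
Fin-sumUpTo↔ (suc n) f = ↔-trans +↔⊎ (↔-trans (Fin-sumUpTo↔ n f ⊎-↔ ↔-refl) Σ≤-suc↔)

Σ≤↔Σ : {X : ℕ → Set} → (∀ k → X k → k ≤ n) → Σ≤ n X ↔ Σ ℕ X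
Σ≤↔Σ bound = mk↔ₛ′ (λ (k , _ , x) → k , x) (λ (k , x) → k , bound k x , x) (λ _ → refl)
  (λ (k , _ , x) → cong (λ p → k , p , x) (≤-irrelevant _ _))

-- A class of objects graded by a z-degree and a q-degree; f Counts C says that f is its generating
-- function, witnessed by explicit bijections.
record Class : Set₁ where
  field
    Obj       : Set
    zdeg qdeg : Obj → ℕ

open Class

Fiber : Class → ℕ → ℕ → Set
Fiber C i j = Σ (Obj C) λ d → zdeg C d ≡ i × qdeg C d ≡ j

infix 4 _Counts_
_Counts_ : Series → Class → Set
f Counts C = ∀ i j → Fin (f i j) ↔ Fiber C i j

Counts-transport : ∀ {f C D} → f Counts C → (e : Obj C ↔ Obj D) →
  (∀ d → zdeg D (Inverse.to e d) ≡ zdeg C d) → (∀ d → qdeg D (Inverse.to e d) ≡ qdeg C d) →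
  f Counts D
Counts-transport {C = C} {D} count e zdeg-to qdeg-to i j = ↔-trans (count i j)
  (↔-restrict (×-irrelevant ≡-irrelevant ≡-irrelevant) (×-irrelevant ≡-irrelevant ≡-irrelevant) to from
    (λ (p , q) → trans (zdeg-to _) p , trans (qdeg-to _) q)
    (λ {d} (p , q) → trans (sym (zdeg-from d)) p , trans (sym (qdeg-from d)) q)
    (λ _ → strictlyInverseʳ _) (λ _ → strictlyInverseˡ _))
  where
  open Inverse e
  zdeg-from : ∀ d → zdeg D d ≡ zdeg C (from d)
  zdeg-from d = trans (cong (zdeg D) (sym (strictlyInverseˡ d))) (zdeg-to (from d))
  qdeg-from : ∀ d → qdeg D d ≡ qdeg C (from d)
  qdeg-from d = trans (cong (qdeg D) (sym (strictlyInverseˡ d))) (qdeg-to (from d))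

point : ℕ → ℕ → Class
point a b = record { Obj = ⊤ ; zdeg = λ _ → a ; qdeg = λ _ → b }

shift : ℕ → ℕ → Class → Class
shift a b C = record { Obj = Obj C ; zdeg = λ d → a + zdeg C d ; qdeg = λ d → b + qdeg C d }

infixr 6 _⊗_
_⊗_ : Class → Class → Class
C ⊗ D = record
  { Obj  = Obj C × Obj D
  ; zdeg = λ (c , d) → zdeg C c + zdeg D d
  ; qdeg = λ (c , d) → qdeg C c + qdeg D d
  }

geometric : ℕ → ℕ → Class
geometric a b = record { Obj = ℕ ; zdeg = λ k → k * a ; qdeg = λ k → k * b }

⨆ : (ℕ → Class) → Class
⨆ C = record
  { Obj  = Σ ℕ (Obj ∘ C)
  ; zdeg = λ (n , d) → zdeg (C n) d
  ; qdeg = λ (n , d) → qdeg (C n) d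
  }

mono-Counts : ∀ a b → mono a b Counts point a b
mono-Counts a b i j = ↔-trans *↔× (↔-trans (Fin-[≡ᵇ]↔≡ i a ×-↔ Fin-[≡ᵇ]↔≡ j b)
  (mk↔ₛ′ (tt ,_) proj₂ (λ _ → refl) (λ _ → refl)))

⊛-Counts : ∀ {f g C D} → f Counts C → g Counts D → f ⊛ g Counts C ⊗ D
⊛-Counts {C = C} {D} countC countD i j =
  ↔-trans (Fin-sumUpTo↔ i _)
  (↔-trans (Σ≤-cong λ a → Fin-sumUpTo↔ j _)
  (↔-trans (Σ≤-cong λ a → Σ≤-cong λ b → ↔-trans *↔× (countC a b ×-↔ countD (i ∸ a) (j ∸ b)))
  convolution))
  where
  complement : ∀ {m n k} → m + n ≡ k → m ≤ k × n ≡ k ∸ m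
  complement {m} {n} refl = m≤m+n m n , sym (m+n∸m≡n m n)

  to : Σ≤ i (λ a → Σ≤ j λ b → Fiber C a b × Fiber D (i ∸ a) (j ∸ b)) → Fiber (C ⊗ D) i j
  to (a , a≤i , b , b≤j , (c , refl , refl) , (d , p , q)) =
    (c , d) , trans (cong (λ m → a + m) p) (m+[n∸m]≡n a≤i) , trans (cong (λ m → b + m) q) (m+[n∸m]≡n b≤j)

  from : Fiber (C ⊗ D) i j → Σ≤ i (λ a → Σ≤ j λ b → Fiber C a b × Fiber D (i ∸ a) (j ∸ b))
  from ((c , d) , p , q) =
    zdeg C c , proj₁ (complement p) , qdeg C c , proj₁ (complement q) ,
    (c , refl , refl) , (d , proj₂ (complement p) , proj₂ (complement q))

  convolution : Σ≤ i (λ a → Σ≤ j λ b → Fiber C a b × Fiber D (i ∸ a) (j ∸ b)) ↔ Fiber (C ⊗ D) i j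
  convolution = mk↔ₛ′ to from
    (λ (cd , pq) → cong (cd ,_) (×-irrelevant ≡-irrelevant ≡-irrelevant _ pq))
    (λ { (a , a≤i , b , b≤j , (c , refl , refl) , (d , p , q)) →
         cong₂ (λ a≤i′ (b≤j′ , p′ , q′) → a , a≤i′ , b , b≤j′ , (c , refl , refl) , (d , p′ , q′))
           (≤-irrelevant _ _)
           (×-irrelevant ≤-irrelevant (×-irrelevant ≡-irrelevant ≡-irrelevant) _ _) })

mono-⊛-Counts : ∀ {f C} a b → f Counts C → mono a b ⊛ f Counts shift a b C
mono-⊛-Counts a b count = Counts-transport (⊛-Counts (mono-Counts a b) count)
  (mk↔ₛ′ proj₂ (tt ,_) (λ _ → refl) (λ _ → refl)) (λ _ → refl) (λ _ → refl)

geomInv-Counts : ∀ a b → 1 ≤ b → geomInv a b Counts geometric a b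
geomInv-Counts a b 1≤b i j =
  ↔-trans (Fin-sumUpTo↔ j _)
  (↔-trans (Σ≤-cong λ k → ↔-trans *↔× (Fin-[≡ᵇ]↔≡ i (k * a) ×-↔ Fin-[≡ᵇ]↔≡ j (k * b)))
  (Σ≤↔Σ λ k (_ , k*b≡j) → subst (k ≤_) k*b≡j (m≤m*n k b {{>-nonZero 1≤b}})))

sumUpTo-Counts : {F : ℕ → Series} {C : ℕ → Class} → (∀ n → F n Counts C n) →
  (∀ n d → n ≤ qdeg (C n) d) → (λ i j → sumUpTo j λ n → F n i j) Counts ⨆ C
sumUpTo-Counts count bound i j =
  ↔-trans (Fin-sumUpTo↔ j _)
  (↔-trans (Σ≤-cong λ n → count n i j)
  (↔-trans (Σ≤↔Σ λ n (d , _ , qdeg≡j) → subst (n ≤_) qdeg≡j (bound n d))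
  (↔-sym Σ-assoc)))

weight : (ℕ → ℕ) → Vec ℕ n → ℕ
weight w []       = 0
weight w (x ∷ xs) = x * w 0 + weight (w ∘ suc) xs

weight-∷ʳ : ∀ w (xs : Vec ℕ n) x → weight w (xs ∷ʳ x) ≡ weight w xs + x * w n
weight-∷ʳ w []       x = +-comm (x * w 0) 0
weight-∷ʳ w (y ∷ xs) x = trans (cong (λ m → y * w 0 + m) (weight-∷ʳ (w ∘ suc) xs x))
  (sym (+-assoc (y * w 0) _ _))

multiplicities : (ℕ → ℕ) → (ℕ → ℕ) → ℕ → Class
multiplicities a b n = record { Obj = Vec ℕ n ; zdeg = weight a ; qdeg = weight b }

-- prodBelow (suc n) appends its last factor, so vectors grow at the end and entry k remains the
-- multiplicity of factor k.
∷ʳ-↔ : (Vec A n × A) ↔ Vec A (suc n)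
∷ʳ-↔ = mk↔ₛ′ (λ (xs , x) → xs ∷ʳ x) (λ v → init v , last v)
  (λ v → sym (proj₂ (proj₂ (initLast v))))
  (λ (xs , x) → cong₂ _,_ (init-∷ʳ x xs) (last-∷ʳ x xs))

prodBelow-Counts : ∀ a b → (∀ k → 1 ≤ b k) → ∀ n →
  prodBelow n (λ k → geomInv (a k) (b k)) Counts multiplicities a b n
prodBelow-Counts a b 1≤b zero = Counts-transport (mono-Counts 0 0)
  (mk↔ₛ′ (λ _ → []) (λ _ → tt) (λ { [] → refl }) (λ _ → refl)) (λ _ → refl) (λ _ → refl)
prodBelow-Counts a b 1≤b (suc n) = Counts-transport
  (⊛-Counts (prodBelow-Counts a b 1≤b n) (geomInv-Counts (a n) (b n) (1≤b n)))
  ∷ʳ-↔ (λ (xs , k) → weight-∷ʳ a xs k) (λ (xs , k) → weight-∷ʳ b xs k)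

∧-intro : ∀ {a b} → T a → T b → T (a ∧ b)
∧-intro p q = Equivalence.from T-∧ (p , q)

-- The first conjunct is explicit: Agda cannot recover it from T (a ∧ b).
∧-elim : ∀ a {b} → T (a ∧ b) → T a × T b
∧-elim _ = Equivalence.to T-∧

evenᵇ⇒∣ : T (evenᵇ n) → 2 ∣ n
evenᵇ⇒∣ {n} e = m%n≡0⇒n∣m n 2 (≡ᵇ⇒≡ (n % 2) 0 e)

∣⇒evenᵇ : 2 ∣ n → T (evenᵇ n)
∣⇒evenᵇ {n} 2∣n = ≡⇒≡ᵇ (n % 2) 0 (n∣m⇒m%n≡0 n 2 2∣n)

-- Least second part of a pair placed on top of R (an empty R ends in the virtual part −2).
pairFloor : List ℕ → ℕ
pairFloor []      = 0
pairFloor (x ∷ _) = 2 + x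

pair : ℕ → ℕ → List ℕ → List ℕ
pair x zero    R = x ∷ R
pair x (suc y) R = x ∷ suc y ∷ R

pairOn : ℕ → ℕ → List ℕ → List ℕ
pairOn c h R = pair (pairFloor R + 2 * h + suc c) (pairFloor R + 2 * h) R

Pairs : Set
Pairs = Σ ℕ λ n → Vec ℕ n × Vec ℕ n

consPairs : ℕ → ℕ → Pairs → Pairs
consPairs c h (n , cs , hs) = suc n , c ∷ cs , h ∷ hs

stackPairs : Vec ℕ n → Vec ℕ n → List ℕ
stackPairs []       []       = []
stackPairs (c ∷ cs) (h ∷ hs) = pairOn c h (stackPairs cs hs)

toPartition : Pairs → List ℕ
toPartition (_ , cs , hs) = stackPairs cs hs

fromPartition : List ℕ → Pairs
fromPartition []          = 0 , [] , []
fromPartition (x ∷ [])    = consPairs (x ∸ 1) 0 (fromPartition [])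
fromPartition (x ∷ y ∷ R) = consPairs (x ∸ suc y) ((y ∸ pairFloor R) / 2) (fromPartition R)

inGᵇ-pairOn : ∀ c h R → T (inGᵇ R) → T (inGᵇ (pairOn c h R))
inGᵇ-pairOn c zero    []      _ = tt
inGᵇ-pairOn c (suc h) []      _ =
  ∧-intro (∧-intro (<⇒<ᵇ (m<m+n (2 * suc h) z<s)) tt) (∣⇒evenᵇ (m∣m*n (suc h)))
inGᵇ-pairOn c h       (z ∷ R) v =
  ∧-intro (∧-intro (<⇒<ᵇ (m<m+n y z<s)) (∧-intro (<⇒<ᵇ z<y) (proj₁ valid)))
          (∧-intro (subst (λ k → T (evenᵇ k)) (sym gap) (∣⇒evenᵇ (m∣m*n h))) (proj₂ valid))
  where
  valid = ∧-elim (distinctPartsᵇ (z ∷ R)) v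
  y = 2 + z + 2 * h
  z<y : z < y
  z<y = s≤s (m≤n⇒m≤1+n (m≤m+n z (2 * h)))
  gap : y ∸ z ≡ 2 + 2 * h
  gap = trans (+-∸-assoc 2 (m≤m+n z (2 * h))) (cong (λ m → 2 + m) (m+n∸m≡n z (2 * h)))

stackPairs-inGᵇ : (cs hs : Vec ℕ n) → T (inGᵇ (stackPairs cs hs))
stackPairs-inGᵇ []       []       = tt
stackPairs-inGᵇ (c ∷ cs) (h ∷ hs) = inGᵇ-pairOn c h (stackPairs cs hs) (stackPairs-inGᵇ cs hs)

even-gap : ∀ z y → z < y → T (evenᵇ (y ∸ z)) → 2 + z + 2 * ((y ∸ (2 + z)) / 2) ≡ y
even-gap zero    (suc (suc y)) _         e = cong (λ m → 2 + m) (m*[n/m]≡n (evenᵇ⇒∣ e))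
even-gap (suc z) (suc y)       (s≤s z<y) e = cong suc (even-gap z y z<y e)

inGᵇ-∷-∷⁻ : ∀ x y R → T (inGᵇ (x ∷ y ∷ R)) →
  y < x × pairFloor R + 2 * ((y ∸ pairFloor R) / 2) ≡ y × T (inGᵇ R)
inGᵇ-∷-∷⁻ x y [] v = <ᵇ⇒< y x y<ᵇx , m*[n/m]≡n (evenᵇ⇒∣ even) , tt
  where
  y<ᵇx : T (y <ᵇ x)
  y<ᵇx = proj₁ (∧-elim (y <ᵇ x) (proj₁ (∧-elim (distinctPartsᵇ (x ∷ y ∷ [])) v)))
  even : T (evenᵇ y)
  even = proj₂ (∧-elim (distinctPartsᵇ (x ∷ y ∷ [])) v)
inGᵇ-∷-∷⁻ x y (z ∷ R) v =
  <ᵇ⇒< y x y<ᵇx , even-gap z y (<ᵇ⇒< z y z<ᵇy) even , ∧-intro distinctR oddR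
  where
  distinct = ∧-elim (distinctPartsᵇ (x ∷ y ∷ z ∷ R)) v
  y<ᵇx×distinctY = ∧-elim (y <ᵇ x) (proj₁ distinct)
  z<ᵇy×distinctR = ∧-elim (z <ᵇ y) (proj₂ y<ᵇx×distinctY)
  even×oddR = ∧-elim (evenᵇ (y ∸ z)) (proj₂ distinct)
  y<ᵇx = proj₁ y<ᵇx×distinctY
  z<ᵇy = proj₁ z<ᵇy×distinctR
  distinctR = proj₂ z<ᵇy×distinctR
  even = proj₁ even×oddR
  oddR = proj₂ even×oddR

¬inGᵇ-∷-0 : ∀ x R → ¬ T (inGᵇ (x ∷ 0 ∷ R))
¬inGᵇ-∷-0 zero    R       ()
¬inGᵇ-∷-0 (suc x) []      ()
¬inGᵇ-∷-0 (suc x) (z ∷ R) ()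

pairOn-unpair : ∀ x y R → T (inGᵇ (x ∷ y ∷ R)) →
  pairOn (x ∸ suc y) ((y ∸ pairFloor R) / 2) R ≡ x ∷ y ∷ R
pairOn-unpair x zero    R v = contradiction v (¬inGᵇ-∷-0 x R)
pairOn-unpair x (suc y) R v =
  trans (cong (λ y′ → pair (y′ + suc c) y′ R) floor+2h≡y)
        (cong (_∷ suc y ∷ R) (trans (+-suc (suc y) c) (m+[n∸m]≡n y<x)))
  where
  c = x ∸ suc (suc y)
  y<x = proj₁ (inGᵇ-∷-∷⁻ x (suc y) R v)
  floor+2h≡y = proj₁ (proj₂ (inGᵇ-∷-∷⁻ x (suc y) R v))

toPartition-fromPartition : ∀ l → T (inGᵇ l) → toPartition (fromPartition l) ≡ l
toPartition-fromPartition []           _ = refl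
toPartition-fromPartition (suc x ∷ []) _ = refl
toPartition-fromPartition (x ∷ y ∷ R)  v =
  trans (cong (pairOn (x ∸ suc y) ((y ∸ pairFloor R) / 2)) (toPartition-fromPartition R validR))
        (pairOn-unpair x y R v)
  where
  validR = proj₂ (proj₂ (inGᵇ-∷-∷⁻ x y R v))

unpair-pairOn : ∀ c h R → let y = pairFloor R + 2 * h in
  consPairs ((y + suc c) ∸ suc y) ((y ∸ pairFloor R) / 2) (fromPartition R) ≡ consPairs c h (fromPartition R)
unpair-pairOn c h R = cong₂ (λ c′ h′ → consPairs c′ h′ (fromPartition R))
  (trans (cong (_∸ suc y) (+-suc y c)) (m+n∸m≡n y c))
  (trans (cong (_/ 2) (m+n∸m≡n (pairFloor R) (2 * h))) (trans (cong (_/ 2) (*-comm 2 h)) (m*n/n≡m h 2)))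
  where
  y = pairFloor R + 2 * h

fromPartition-pairOn : ∀ c h R → fromPartition (pairOn c h R) ≡ consPairs c h (fromPartition R)
fromPartition-pairOn c zero    []      = refl
fromPartition-pairOn c (suc h) []      = unpair-pairOn c (suc h) []
fromPartition-pairOn c h       (z ∷ R) = unpair-pairOn c h (z ∷ R)

fromPartition-stackPairs : (cs hs : Vec ℕ n) → fromPartition (stackPairs cs hs) ≡ (n , cs , hs)
fromPartition-stackPairs []       []       = refl
fromPartition-stackPairs (c ∷ cs) (h ∷ hs) = trans (fromPartition-pairOn c h (stackPairs cs hs))
  (cong (consPairs c h) (fromPartition-stackPairs cs hs))

weight-zero : (xs : Vec ℕ n) → weight (λ _ → 0) xs ≡ 0
weight-zero []       = refl
weight-zero (x ∷ xs) = cong₂ _+_ (*-zeroʳ x) (weight-zero xs)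

weight-shift : ∀ w d → (∀ k → w (suc k) ≡ w k + d) →
  (xs : Vec ℕ n) → weight (w ∘ suc) xs ≡ weight w xs + d * sum xs
weight-shift w d w-step []       = sym (*-zeroʳ d)
weight-shift w d w-step (x ∷ xs) = begin
  x * w 1 + weight (w ∘ suc ∘ suc) xs
    ≡⟨ cong₂ (λ u v → x * u + v) (w-step 0) (weight-shift (w ∘ suc) d (w-step ∘ suc) xs) ⟩
  x * (w 0 + d) + (weight (w ∘ suc) xs + d * sum xs)
    ≡⟨ distribute x (w 0) d (weight (w ∘ suc) xs) (sum xs) ⟩
  x * w 0 + weight (w ∘ suc) xs + d * (x + sum xs) ∎
  where
  open ≡-Reasoning
  distribute : ∀ x a d W S → x * (a + d) + (W + d * S) ≡ x * a + W + d * (x + S)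
  distribute = solve-∀

pairFloor-pair : ∀ x y R → pairFloor (pair x y R) ≡ 2 + x
pairFloor-pair x zero    R = refl
pairFloor-pair x (suc y) R = refl

size-pair : ∀ x y R → size (pair x y R) ≡ x + (y + size R)
size-pair x zero    R = refl
size-pair x (suc y) R = refl

pairFloor-stackPairs : (cs hs : Vec ℕ n) → pairFloor (stackPairs cs hs) ≡ sum cs + 2 * sum hs + 3 * n
pairFloor-stackPairs []       []       = refl
pairFloor-stackPairs {suc n} (c ∷ cs) (h ∷ hs) = begin
  pairFloor (pairOn c h R)                          ≡⟨ pairFloor-pair (y + suc c) y R ⟩
  2 + (pairFloor R + 2 * h + suc c)
    ≡⟨ cong (λ F → 2 + (F + 2 * h + suc c)) (pairFloor-stackPairs cs hs) ⟩
  2 + (sum cs + 2 * sum hs + 3 * n + 2 * h + suc c) ≡⟨ regroup c h (sum cs) (sum hs) n ⟩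
  c + sum cs + 2 * (h + sum hs) + 3 * suc n         ∎
  where
  open ≡-Reasoning
  R = stackPairs cs hs
  y = pairFloor R + 2 * h
  regroup : ∀ c h S H n → 2 + (S + 2 * H + 3 * n + 2 * h + suc c) ≡ c + S + 2 * (h + H) + 3 * suc n
  regroup = solve-∀

-- Size of the partition with all multiplicities zero, whose pairs are (3k+1, 3k).
minimalSize : ℕ → ℕ
minimalSize zero    = 0
minimalSize (suc n) = minimalSize n + (6 * n + 1)

size-stackPairs : (cs hs : Vec ℕ n) →
  size (stackPairs cs hs) ≡ minimalSize n + weight (λ k → 2 * k + 1) cs + weight (λ k → 4 * k + 4) hs
size-stackPairs []       []       = refl
size-stackPairs {suc n} (c ∷ cs) (h ∷ hs) = begin
  size (pairOn c h R)
    ≡⟨ size-pair (y + suc c) y R ⟩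
  (pairFloor R + 2 * h + suc c) + (pairFloor R + 2 * h + size R)
    ≡⟨ cong₂ (λ F s → (F + 2 * h + suc c) + (F + 2 * h + s))
             (pairFloor-stackPairs cs hs) (size-stackPairs cs hs) ⟩
  (S + 2 * H + 3 * n + 2 * h + suc c) + (S + 2 * H + 3 * n + 2 * h + (minimalSize n + Wc + Wh))
    ≡⟨ regroup c h S H n (minimalSize n) Wc Wh ⟩
  minimalSize n + (6 * n + 1) + (c * 1 + (Wc + 2 * S)) + (h * 4 + (Wh + 4 * H))
    ≡⟨ cong₂ (λ u v → minimalSize n + (6 * n + 1) + (c * 1 + u) + (h * 4 + v))
         (sym (weight-shift (λ k → 2 * k + 1) 2 odd-step cs))
         (sym (weight-shift (λ k → 4 * k + 4) 4 four-step hs)) ⟩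
  minimalSize (suc n) + weight (λ k → 2 * k + 1) (c ∷ cs) + weight (λ k → 4 * k + 4) (h ∷ hs) ∎
  where
  open ≡-Reasoning
  R = stackPairs cs hs
  y = pairFloor R + 2 * h
  S = sum cs
  H = sum hs
  Wc = weight (λ k → 2 * k + 1) cs
  Wh = weight (λ k → 4 * k + 4) hs
  regroup : ∀ c h S H n m Wc Wh →
    (S + 2 * H + 3 * n + 2 * h + suc c) + (S + 2 * H + 3 * n + 2 * h + (m + Wc + Wh))
    ≡ m + (6 * n + 1) + (c * 1 + (Wc + 2 * S)) + (h * 4 + (Wh + 4 * H))
  regroup = solve-∀
  odd-step : ∀ k → 2 * suc k + 1 ≡ 2 * k + 1 + 2
  odd-step = solve-∀
  four-step : ∀ k → 4 * suc k + 4 ≡ 4 * k + 4 + 4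
  four-step = solve-∀

altSum-∷-∷ : ∀ y c R → altSum (y + suc c ∷ y ∷ R) ≡ + suc c ℤ.+ altSum R
altSum-∷-∷ y c R = cancel (+ y) (+ suc c) (altSum R)
  where
  cancel : ∀ p q a → (p ℤ.+ q) ℤ.- (p ℤ.- a) ≡ q ℤ.+ a
  cancel = ℤ-Solver.solve-∀

altSum-pairOn : ∀ c h R → altSum (pairOn c h R) ≡ + suc c ℤ.+ altSum R
altSum-pairOn c zero    []      = refl
altSum-pairOn c (suc h) []      = altSum-∷-∷ (2 * suc h) c []
altSum-pairOn c h       (z ∷ R) = altSum-∷-∷ (2 + z + 2 * h) c (z ∷ R)

altSum-stackPairs : (cs hs : Vec ℕ n) → altSum (stackPairs cs hs) ≡ + (n + weight (λ _ → 1) cs)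
altSum-stackPairs []       []       = refl
altSum-stackPairs {suc n} (c ∷ cs) (h ∷ hs) = begin
  altSum (pairOn c h R)            ≡⟨ altSum-pairOn c h R ⟩
  + suc c ℤ.+ altSum R             ≡⟨ cong (λ a → + suc c ℤ.+ a) (altSum-stackPairs cs hs) ⟩
  + (suc c + (n + W))              ≡⟨ cong +_ (regroup c n W) ⟩
  + (suc n + (c * 1 + W))          ∎
  where
  open ≡-Reasoning
  R = stackPairs cs hs
  W = weight (λ _ → 1) cs
  regroup : ∀ c n W → suc c + (n + W) ≡ suc n + (c * 1 + W)
  regroup = solve-∀

minimalSize+2n : ∀ n → minimalSize n + 2 * n ≡ 3 * n * n
minimalSize+2n zero    = refl
minimalSize+2n (suc n) = begin
  minimalSize n + (6 * n + 1) + 2 * suc n ≡⟨ regroup (minimalSize n) n ⟩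
  minimalSize n + 2 * n + (6 * n + 3)     ≡⟨ cong (_+ (6 * n + 3)) (minimalSize+2n n) ⟩
  3 * n * n + (6 * n + 3)                 ≡⟨ square n ⟩
  3 * suc n * suc n                       ∎
  where
  open ≡-Reasoning
  regroup : ∀ m n → m + (6 * n + 1) + 2 * suc n ≡ m + 2 * n + (6 * n + 3)
  regroup = solve-∀
  square : ∀ n → 3 * n * n + (6 * n + 3) ≡ 3 * suc n * suc n
  square = solve-∀

minimalSize≡3n²∸2n : ∀ n → 3 * n * n ∸ 2 * n ≡ minimalSize n
minimalSize≡3n²∸2n n = trans (cong (_∸ 2 * n) (sym (minimalSize+2n n))) (m+n∸n≡m (minimalSize n) (2 * n))

n≤minimalSize : ∀ n → n ≤ minimalSize n
n≤minimalSize zero    = z≤n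
n≤minimalSize (suc n) =
  subst (_≤ minimalSize (suc n)) (+-comm n 1) (+-mono-≤ (n≤minimalSize n) (m≤n+m 1 (6 * n)))

rhsClass : Class
rhsClass = ⨆ λ n → shift n (3 * n * n ∸ 2 * n) (multiplicities (λ _ → 1) (λ k → 2 * k + 1) n)
                   ⊗ multiplicities (λ _ → 0) (λ k → 4 * k + 4) n

rhs-Counts : rhs Counts rhsClass
rhs-Counts = sumUpTo-Counts
  (λ n → ⊛-Counts
    (mono-⊛-Counts n (3 * n * n ∸ 2 * n)
      (prodBelow-Counts (λ _ → 1) (λ k → 2 * k + 1) (λ k → m≤n+m 1 (2 * k)) n))
    (prodBelow-Counts (λ _ → 0) (λ k → 4 * k + 4) (λ k → ≤-trans (s≤s z≤n) (m≤n+m 4 (4 * k))) n))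
  (λ n (cs , hs) → ≤-trans (subst (n ≤_) (sym (minimalSize≡3n²∸2n n)) (n≤minimalSize n))
                           (≤-trans (m≤m+n _ _) (m≤m+n _ _)))

zdeg-rhsClass : ∀ p → + zdeg rhsClass p ≡ altSum (toPartition p)
zdeg-rhsClass (n , cs , hs) =
  trans (cong (λ w → + (n + weight (λ _ → 1) cs + w)) (weight-zero hs))
        (trans (cong +_ (+-identityʳ _)) (sym (altSum-stackPairs cs hs)))

qdeg-rhsClass : ∀ p → qdeg rhsClass p ≡ size (toPartition p)
qdeg-rhsClass (n , cs , hs) =
  trans (cong (λ m → m + weight (λ k → 2 * k + 1) cs + weight (λ k → 4 * k + 4) hs)
              (minimalSize≡3n²∸2n n))
        (sym (size-stackPairs cs hs))

rhsClass-Fiber↔𝒢 : ∀ i j →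
  Fiber rhsClass i j ↔ Σ (List ℕ) (λ l → T (inGᵇ l) × size l ≡ j × altSum l ≡ + i)
rhsClass-Fiber↔𝒢 i j = ↔-restrict
  (×-irrelevant ≡-irrelevant ≡-irrelevant)
  (×-irrelevant T-irrelevant (×-irrelevant ≡-irrelevant (Decidable⇒UIP.≡-irrelevant ℤ._≟_)))
  toPartition fromPartition
  (λ { {p@(_ , cs , hs)} (zdeg≡i , qdeg≡j) → stackPairs-inGᵇ cs hs ,
     trans (sym (qdeg-rhsClass p)) qdeg≡j , trans (sym (zdeg-rhsClass p)) (cong +_ zdeg≡i) })
  (λ {l} (valid , size≡j , altSum≡i) → let e = toPartition-fromPartition l valid in
     +-injective (trans (zdeg-rhsClass (fromPartition l)) (trans (cong altSum e) altSum≡i)) ,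
     trans (qdeg-rhsClass (fromPartition l)) (trans (cong size e) size≡j))
  (λ { {_ , cs , hs} _ → fromPartition-stackPairs cs hs })
  (λ {l} (valid , _) → toPartition-fromPartition l valid)

theorem5p5 : (i j : ℕ) →
    Σ (List ℕ) (λ l → T (inGᵇ l) × (size l ≡ j) × (altSum l ≡ + i)) ↔ Fin (rhs i j)
theorem5p5 i j = ↔-sym (↔-trans (rhs-Counts i j) (rhsClass-Fiber↔𝒢 i j))
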